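{- Let $(C_n,\mathbf{w})$ be a weighted cycle ($n\ge 3$) and $(P_m,\mathbf{w}')$ a weighted path. Then $c\big(C_n\square P_m,\mathbf{w}\square\mathbf{w}'\big)=c(C_n,\mathbf{w})+c(P_m,\mathbf{w}')$.
   Context: A weighted graph is a finite simple graph with positive integer edge weights that is weight-minimal: every edge is a shortest path between its endpoints. $d_\mathbf{w}$ is the weighted shortest-path distance. A binary addressing of length $m$ is a map $f:V\to\{0,1\}^m$ with $d_\mathbf{w}(u,v)\le d_H(f(u),f(v))$ for all $u,v$ ($d_H$ Hamming distance); $c(G,\mathbf{w})$ is the minimum such $m$. The weighted Cartesian product $(G_1\square G_2,\mathbf{w}_1\square\mathbf{w}_2)$ has vertex set $V(G_1)\times V(G_2)$; $(u,x)$ and $(v,x)$ are joined by an edge of weight $\mathbf{w}_1(uv)$ when $uv\in E(G_1)$, and $(u,x)$ and $(u,y)$ by an edge of weight $\mathbf{w}_2(xy)$ when $xy\in E(G_2)$. -}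

module Defs where

open import Data.Nat using (ℕ; zero; suc; _+_; _≤_; _<_)
open import Data.Fin using (Fin; toℕ)
open import Data.Bool using (Bool; true; false)
open import Data.Vec using (Vec; []; _∷_)
open import Data.Product using (Σ; _×_; _,_)
open import Data.Sum using (_⊎_)
open import Relation.Binary.PropositionalEquality using (_≡_)

-- A weighted edge relation on a vertex type V:
--   E u v k  means  "uv is an edge of weight k".
EdgeRel : Set → Set₁
EdgeRel V = V → V → ℕ → Set

data Walk {V : Set} (E : EdgeRel V) : V → V → ℕ → Set where
  nil  : ∀ {u} → Walk E u u 0
  cons : ∀ {u v x k l} → E u v k → Walk E v x l → Walk E u x (k + l)

IsDist : {V : Set} → EdgeRel V → V → V → ℕ → Set
IsDist E u v d = Walk E u v d × (∀ l → Walk E u v l → d ≤ l)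

IsWeighted : {V : Set} → EdgeRel V → Set
IsWeighted E =
  (∀ u v k → E u v k → 0 < k) × (∀ u v k → E u v k → IsDist E u v k)

hamming : ∀ {m} → Vec Bool m → Vec Bool m → ℕ
hamming [] [] = 0
hamming (true ∷ xs) (true ∷ ys) = hamming xs ys
hamming (false ∷ xs) (false ∷ ys) = hamming xs ys
hamming (true ∷ xs) (false ∷ ys) = suc (hamming xs ys)
hamming (false ∷ xs) (true ∷ ys) = suc (hamming xs ys)

IsAddressing : {V : Set} → EdgeRel V → (m : ℕ) → (V → Vec Bool m) → Set
IsAddressing {V} E m f = ∀ (u v : V) d → IsDist E u v d → d ≤ hamming (f u) (f v)

IsAddrNumber : {V : Set} → EdgeRel V → ℕ → Set
IsAddrNumber {V} E c =
  Σ (V → Vec Bool c) (IsAddressing E c) ×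
  (∀ m (f : V → Vec Bool m) → IsAddressing E m f → c ≤ m)

CycSucc : ∀ {n} → Fin n → Fin n → Set
CycSucc {n} i j = (suc (toℕ i) ≡ toℕ j) ⊎ ((suc (toℕ i) ≡ n) × (toℕ j ≡ 0))

data CycleE (n : ℕ) (w : Fin n → ℕ) : EdgeRel (Fin n) where
  fwd : ∀ {i j} → CycSucc i j → CycleE n w i j (w i)
  bwd : ∀ {i j} → CycSucc i j → CycleE n w j i (w i)

-- Weighted path P_m on vertices Fin m: w i is the weight of the edge {i, i+1}
-- (the value at the last vertex is unused).
data PathE (m : ℕ) (w : Fin m → ℕ) : EdgeRel (Fin m) where
  fwd : ∀ {i j} → suc (toℕ i) ≡ toℕ j → PathE m w i j (w i)
  bwd : ∀ {i j} → suc (toℕ i) ≡ toℕ j → PathE m w j i (w i)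

data ProdE {V₁ V₂ : Set} (E₁ : EdgeRel V₁) (E₂ : EdgeRel V₂) : EdgeRel (V₁ × V₂) where
  left  : ∀ {u v x k} → E₁ u v k → ProdE E₁ E₂ (u , x) (v , x) k
  right : ∀ {u x y k} → E₂ x y k → ProdE E₁ E₂ (u , x) (u , y) k

{-# OPTIONS --safe #-}
module Submission where

open import Defs
open import Data.Nat
  using (+-0-rawMonoid; ℕ; zero; suc; _+_; _∸_; _≤_; _<_; _⊓_; _≤?_; _<?_; ∣_-_∣; ⌊_/2⌋; ⌈_/2⌉; z≤n; s≤s)
open import Data.Nat.Properties
open import Data.Nat.Induction using (<-rec)
open import Data.Nat.Tactic.RingSolver using (solve-∀)
open import Algebra.Definitions.RawMonoid +-0-rawMonoid using (sum)
open import Algebra.Properties.CommutativeSemigroup +-commutativeSemigroup using (x∙yz≈y∙xz)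
open import Data.Fin using (Fin; toℕ; fromℕ; fromℕ<) renaming (zero to fzero; suc to fsuc)
open import Data.Fin.Properties using (toℕ<n; toℕ-fromℕ; toℕ-fromℕ<; toℕ-injective; ≤fromℕ)
open import Data.Bool using (Bool; true; false; not)
open import Data.Vec using (Vec; []; _∷_; _++_; map)
open import Data.Product using (∃; ∃₂; ∃-syntax; _×_; _,_; proj₁; proj₂)
open import Data.Sum using (inj₁; inj₂)
open import Function using (_∘_; id)
open import Relation.Nullary using (¬_; yes; no)
open import Relation.Nullary.Decidable using (decidable-stable)
open import Relation.Binary.PropositionalEquality

-- Product distances are sums of factor distances, so concatenating addressings of the
-- factors addresses the product; this gives c(C □ P) ≤ c(C) + c(P).
--
-- Conversely, place vertex i of the cycle at position w 0 + … + w (i-1) on a circle of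
-- circumference W (the total weight), and the path on a segment of length D. A cyclic
-- code of length ⌈W/2⌉ and a thermometer code of length D address the factors, so it
-- suffices to show that every addressing of the product has length M ≥ ⌈W/2⌉ + D. Let ij
-- be the cycle edge containing the point antipodal to vertex 0, and consider the product
-- vertices (0, 0), (i, end), (j, end). Lipschitz potentials show that their pairwise
-- distances add up to at least W + 2D, whereas for any three words of length M the three
-- Hamming distances add up to at most 2M.

Undirected : {V : Set} → EdgeRel V → Set
Undirected E = ∀ {u v k} → E u v k → E v u k

module _ {V : Set} {E : EdgeRel V} where

  infixr 5 _++ʷ_

  _++ʷ_ : ∀ {u v x l l′} → Walk E u v l → Walk E v x l′ → Walk E u x (l + l′)
  nil ++ʷ q = q
  _++ʷ_ {l′ = l′} (cons {k = k} {l = l} e p) q =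
    subst (Walk E _ _) (sym (+-assoc k l l′)) (cons e (p ++ʷ q))

  reverse : Undirected E → ∀ {u v l} → Walk E u v l → Walk E v u l
  reverse flip nil = nil
  reverse flip (cons {k = k} {l = l} e p) =
    subst (Walk E _ _) (trans (cong (l +_) (+-identityʳ k)) (+-comm l k))
      (reverse flip p ++ʷ cons (flip e) nil)

  potential-bound : (φ : V → ℕ) → (∀ {u v k} → E u v k → φ v ≤ φ u + k) →
                    ∀ {u v l} → Walk E u v l → φ v ≤ φ u + l
  potential-bound φ lipschitz nil = m≤m+n _ 0
  potential-bound φ lipschitz (cons {u} {v} {x} {k} {l} e p) = begin
    φ x           ≤⟨ potential-bound φ lipschitz p ⟩
    φ v + l       ≤⟨ +-monoˡ-≤ l (lipschitz e) ⟩
    φ u + k + l   ≡⟨ +-assoc (φ u) k l ⟩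
    φ u + (k + l) ∎
    where open ≤-Reasoning

mapʷ : ∀ {V V′ : Set} {E : EdgeRel V} {E′ : EdgeRel V′} (f : V → V′) →
       (∀ {u v k} → E u v k → E′ (f u) (f v) k) →
       ∀ {u v l} → Walk E u v l → Walk E′ (f u) (f v) l
mapʷ f h nil        = nil
mapʷ f h (cons e p) = cons (h e) (mapʷ f h p)

module _ {V₁ V₂ : Set} {E₁ : EdgeRel V₁} {E₂ : EdgeRel V₂} where

  □-walk : ∀ {u v x y l₁ l₂} → Walk E₁ u v l₁ → Walk E₂ x y l₂ →
           Walk (ProdE E₁ E₂) (u , x) (v , y) (l₁ + l₂)
  □-walk {v = v} {x = x} p q = mapʷ (_, x) left p ++ʷ mapʷ (v ,_) right q

  □-split : ∀ {s t l} → Walk (ProdE E₁ E₂) s t l →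
            ∃₂ λ l₁ l₂ → Walk E₁ (proj₁ s) (proj₁ t) l₁ × Walk E₂ (proj₂ s) (proj₂ t) l₂ ×
                         l₁ + l₂ ≡ l
  □-split nil = 0 , 0 , nil , nil , refl
  □-split (cons {k = k} (left e) p) with □-split p
  ... | l₁ , l₂ , p₁ , p₂ , refl = k + l₁ , l₂ , cons e p₁ , p₂ , +-assoc k l₁ l₂
  □-split (cons {k = k} (right e) p) with □-split p
  ... | l₁ , l₂ , p₁ , p₂ , refl = l₁ , k + l₂ , p₁ , cons e p₂ , x∙yz≈y∙xz l₁ k l₂

  □-bound : ∀ {u v x y a b l} →
            (∀ {l₁} → Walk E₁ u v l₁ → a ≤ l₁) →
            (∀ {l₂} → Walk E₂ x y l₂ → b ≤ l₂) →
            Walk (ProdE E₁ E₂) (u , x) (v , y) l → a + b ≤ l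
  □-bound bound₁ bound₂ p with □-split p
  ... | _ , _ , p₁ , p₂ , refl = +-mono-≤ (bound₁ p₁) (bound₂ p₂)

-- Shortest walks exist only classically, which suffices since every conclusion
-- drawn from them is a decidable, hence stable, inequality.
¬¬-least : ∀ {P : ℕ → Set} {l} → P l → ¬ ¬ (∃[ d ] P d × (∀ l → P l → d ≤ l))
¬¬-least {P} {l} Pl noLeast = <-rec (λ k → ¬ P k) noneBelow l Pl
  where
  noneBelow : ∀ k → (∀ {j} → j < k → ¬ P j) → ¬ P k
  noneBelow k below Pk = noLeast (k , Pk , λ j Pj → ≮⇒≥ (λ j<k → below j<k Pj))

addressing-bound : ∀ {V} {E : EdgeRel V} {M f u v l b} → IsAddressing E M f → Walk E u v l →
                   (∀ {l} → Walk E u v l → b ≤ l) → b ≤ hamming (f u) (f v)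
addressing-bound {u = u} {v} addr p bound = decidable-stable (_ ≤? _) λ b≰ →
  ¬¬-least p λ (d , dist) → b≰ (≤-trans (bound (proj₁ dist)) (addr u v d dist))

hamming-comm : ∀ {m} (x y : Vec Bool m) → hamming x y ≡ hamming y x
hamming-comm []          []          = refl
hamming-comm (true ∷ x)  (true ∷ y)  = hamming-comm x y
hamming-comm (false ∷ x) (false ∷ y) = hamming-comm x y
hamming-comm (true ∷ x)  (false ∷ y) = cong suc (hamming-comm x y)
hamming-comm (false ∷ x) (true ∷ y)  = cong suc (hamming-comm x y)

hamming-++ : ∀ {a b} (x y : Vec Bool a) (x′ y′ : Vec Bool b) →
             hamming (x ++ x′) (y ++ y′) ≡ hamming x y + hamming x′ y′
hamming-++ []          []          x′ y′ = refl
hamming-++ (true ∷ x)  (true ∷ y)  x′ y′ = hamming-++ x y x′ y′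
hamming-++ (false ∷ x) (false ∷ y) x′ y′ = hamming-++ x y x′ y′
hamming-++ (true ∷ x)  (false ∷ y) x′ y′ = cong suc (hamming-++ x y x′ y′)
hamming-++ (false ∷ x) (true ∷ y)  x′ y′ = cong suc (hamming-++ x y x′ y′)

hamming-map-not : ∀ {m} (x y : Vec Bool m) → hamming (map not x) (map not y) ≡ hamming x y
hamming-map-not []          []          = refl
hamming-map-not (true ∷ x)  (true ∷ y)  = hamming-map-not x y
hamming-map-not (false ∷ x) (false ∷ y) = hamming-map-not x y
hamming-map-not (true ∷ x)  (false ∷ y) = cong suc (hamming-map-not x y)
hamming-map-not (false ∷ x) (true ∷ y)  = cong suc (hamming-map-not x y)

hamming-complement : ∀ {m} (x y : Vec Bool m) → hamming x (map not y) + hamming x y ≡ m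
hamming-complement []          []          = refl
hamming-complement (true ∷ x)  (true ∷ y)  = cong suc (hamming-complement x y)
hamming-complement (false ∷ x) (false ∷ y) = cong suc (hamming-complement x y)
hamming-complement (true ∷ x)  (false ∷ y) = trans (+-suc _ _) (cong suc (hamming-complement x y))
hamming-complement (false ∷ x) (true ∷ y)  = trans (+-suc _ _) (cong suc (hamming-complement x y))

differ : Bool → Bool → ℕ
differ true  true  = 0
differ false false = 0
differ _     _     = 1

hamming-∷ : ∀ {m} a b (x y : Vec Bool m) → hamming (a ∷ x) (b ∷ y) ≡ differ a b + hamming x y
hamming-∷ true  true  x y = refl
hamming-∷ false false x y = refl
hamming-∷ true  false x y = refl
hamming-∷ false true  x y = refl

differ-perimeter : ∀ a b c → differ a b + differ b c + differ c a ≤ 2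
differ-perimeter true  true  true  = z≤n
differ-perimeter false false false = z≤n
differ-perimeter true  true  false = ≤-refl
differ-perimeter true  false true  = ≤-refl
differ-perimeter true  false false = ≤-refl
differ-perimeter false true  true  = ≤-refl
differ-perimeter false true  false = ≤-refl
differ-perimeter false false true  = ≤-refl

hamming-perimeter : ∀ {m} (x y z : Vec Bool m) → hamming x y + hamming y z + hamming z x ≤ m + m
hamming-perimeter [] [] [] = z≤n
hamming-perimeter {suc m} (a ∷ x) (b ∷ y) (c ∷ z) = begin
  hamming (a ∷ x) (b ∷ y) + hamming (b ∷ y) (c ∷ z) + hamming (c ∷ z) (a ∷ x)
    ≡⟨ cong₂ _+_ (cong₂ _+_ (hamming-∷ a b x y) (hamming-∷ b c y z)) (hamming-∷ c a z x) ⟩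
  (differ a b + hamming x y) + (differ b c + hamming y z) + (differ c a + hamming z x)
    ≡⟨ regroup (differ a b) (differ b c) (differ c a) (hamming x y) (hamming y z) (hamming z x) ⟩
  (differ a b + differ b c + differ c a) + (hamming x y + hamming y z + hamming z x)
    ≤⟨ +-mono-≤ (differ-perimeter a b c) (hamming-perimeter x y z) ⟩
  2 + (m + m)
    ≡⟨ cong suc (+-suc m m) ⟨
  suc m + suc m ∎
  where
  open ≤-Reasoning
  regroup : ∀ a b c x y z → (a + x) + (b + y) + (c + z) ≡ (a + b + c) + (x + y + z)
  regroup = solve-∀

□-addressing : ∀ {V₁ V₂ : Set} {E₁ : EdgeRel V₁} {E₂ : EdgeRel V₂} {a b f g} →
               IsAddressing E₁ a f → IsAddressing E₂ b g →
               IsAddressing (ProdE E₁ E₂) (a + b) (λ (u , x) → f u ++ g x)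
□-addressing {f = f} {g} f-addr g-addr (u , x) (v , y) d (p , minimal)
  with _ , _ , p₁ , p₂ , _ ← □-split p =
  decidable-stable (_ ≤? _) λ d≰ →
  ¬¬-least p₁ λ (d₁ , dist₁) → ¬¬-least p₂ λ (d₂ , dist₂) → d≰ (begin
    d
      ≤⟨ minimal _ (□-walk (proj₁ dist₁) (proj₁ dist₂)) ⟩
    d₁ + d₂
      ≤⟨ +-mono-≤ (f-addr u v d₁ dist₁) (g-addr x y d₂ dist₂) ⟩
    hamming (f u) (f v) + hamming (g x) (g y)
      ≡⟨ hamming-++ (f u) (f v) (g x) (g y) ⟨
    hamming (f u ++ g x) (f v ++ g y) ∎)
  where open ≤-Reasoning

thermometer : (K p : ℕ) → Vec Bool K
thermometer zero    p       = []
thermometer (suc K) zero    = false ∷ thermometer K zero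
thermometer (suc K) (suc p) = true ∷ thermometer K p

hamming-thermometer : ∀ {K p q} → p ≤ K → q ≤ K →
                      hamming (thermometer K p) (thermometer K q) ≡ ∣ p - q ∣
hamming-thermometer {zero}  z≤n z≤n = refl
hamming-thermometer {suc K} {zero}  {zero}  _         _         = hamming-thermometer {K} z≤n z≤n
hamming-thermometer {suc K} {zero}  {suc q} _         (s≤s q≤K) = cong suc (hamming-thermometer z≤n q≤K)
hamming-thermometer {suc K} {suc p} {zero}  (s≤s p≤K) _         =
  cong suc (trans (hamming-thermometer p≤K z≤n) (∣-∣-identityʳ p))
hamming-thermometer {suc K} {suc p} {suc q} (s≤s p≤K) (s≤s q≤K) = hamming-thermometer p≤K q≤K

circ : (c p q : ℕ) → ℕ
circ c p q = ∣ p - q ∣ ⊓ (c ∸ ∣ p - q ∣)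

circ-comm : ∀ c p q → circ c p q ≡ circ c q p
circ-comm c p q = cong (λ x → x ⊓ (c ∸ x)) (∣-∣-comm p q)

circ-mono : ∀ {c c′} p q → c ≤ c′ → circ c p q ≤ circ c′ p q
circ-mono p q c≤c′ = ⊓-monoʳ-≤ ∣ p - q ∣ (∸-monoˡ-≤ ∣ p - q ∣ c≤c′)

⊓∸-lipschitz : ∀ {c x x′ δ} → x′ ≤ x + δ → x ≤ x′ + δ →
               x′ ⊓ (c ∸ x′) ≤ x ⊓ (c ∸ x) + δ
⊓∸-lipschitz {c} {x} {x′} {δ} x′≤x+δ x≤x′+δ = begin
  x′ ⊓ (c ∸ x′)          ≤⟨ ⊓-monoʳ-≤ x′ (m≤n+o⇒m∸n≤o c x′ c≤x′+[c∸x+δ]) ⟩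
  x′ ⊓ (c ∸ x + δ)       ≤⟨ ⊓-monoˡ-≤ (c ∸ x + δ) x′≤x+δ ⟩
  (x + δ) ⊓ (c ∸ x + δ)  ≡⟨ +-distribʳ-⊓ δ x (c ∸ x) ⟨
  x ⊓ (c ∸ x) + δ        ∎
  where
  open ≤-Reasoning
  c≤x′+[c∸x+δ] : c ≤ x′ + (c ∸ x + δ)
  c≤x′+[c∸x+δ] = begin
    c                   ≤⟨ m≤n+m∸n c x ⟩
    x + (c ∸ x)         ≤⟨ +-monoˡ-≤ (c ∸ x) x≤x′+δ ⟩
    x′ + δ + (c ∸ x)    ≡⟨ +-assoc x′ δ (c ∸ x) ⟩
    x′ + (δ + (c ∸ x))  ≡⟨ cong (x′ +_) (+-comm δ (c ∸ x)) ⟩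
    x′ + (c ∸ x + δ)    ∎

circ-lipschitz : ∀ c q p p′ → circ c q p′ ≤ circ c q p + ∣ p - p′ ∣
circ-lipschitz c q p p′ = ⊓∸-lipschitz (∣-∣-triangle q p p′)
  (subst (∣ q - p ∣ ≤_) (cong (∣ q - p′ ∣ +_) (∣-∣-comm p′ p)) (∣-∣-triangle q p′ p))

circ-antipodal : ∀ {K p} b → p ≤ K → circ (K + K) p (K + b) ≤ K ∸ ∣ p - b ∣
circ-antipodal {K} {p} b p≤K with ≤-total b p
... | inj₁ b≤p with r , refl ← m≤n⇒∃[o]m+o≡n b≤p = begin
  circ (K + K) (b + r) (K + b) ≤⟨ m⊓n≤m _ _ ⟩
  ∣ b + r - K + b ∣            ≡⟨ cong (∣ b + r -_∣) (+-comm K b) ⟩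
  ∣ b + r - b + K ∣            ≡⟨ ∣m+n-m+o∣≡∣n-o∣ b r K ⟩
  ∣ r - K ∣                    ≡⟨ m≤n⇒∣m-n∣≡n∸m (≤-trans (m≤n+m r b) p≤K) ⟩
  K ∸ r                        ≡⟨ cong (K ∸_) (trans (∣-∣-comm (b + r) b) (∣m-m+n∣≡n b r)) ⟨
  K ∸ ∣ b + r - b ∣            ∎
  where open ≤-Reasoning
... | inj₂ p≤b with r , refl ← m≤n⇒∃[o]m+o≡n p≤b = begin
  circ (K + K) p (K + (p + r)) ≤⟨ m⊓n≤n _ _ ⟩
  K + K ∸ ∣ p - K + (p + r) ∣  ≡⟨ cong (λ x → K + K ∸ ∣ p - x ∣) (x∙yz≈y∙xz K p r) ⟩
  K + K ∸ ∣ p - p + (K + r) ∣  ≡⟨ cong (K + K ∸_) (∣m-m+n∣≡n p (K + r)) ⟩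
  K + K ∸ (K + r)              ≡⟨ [m+n]∸[m+o]≡n∸o K K r ⟩
  K ∸ r                        ≡⟨ cong (K ∸_) (∣m-m+n∣≡n p r) ⟨
  K ∸ ∣ p - p + r ∣            ∎
  where open ≤-Reasoning

∣m∸o-n∸o∣≡∣m-n∣ : ∀ {m n o} → o ≤ m → o ≤ n → ∣ m ∸ o - n ∸ o ∣ ≡ ∣ m - n ∣
∣m∸o-n∸o∣≡∣m-n∣ z≤n       z≤n       = refl
∣m∸o-n∸o∣≡∣m-n∣ (s≤s o≤m) (s≤s o≤n) = ∣m∸o-n∸o∣≡∣m-n∣ o≤m o≤n

-- Bit i of cyclic K p is set iff p ∸ K ≤ i < p. As p runs from 0 to K + K every bit is
-- switched on once and off once, so the code winds once around a circle of length K + K.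
cyclic : (K p : ℕ) → Vec Bool K
cyclic K p with p ≤? K
... | yes _ = thermometer K p
... | no  _ = map not (thermometer K (p ∸ K))

circ≤hamming-antipodal : ∀ {K p q} → p ≤ K → K < q → q ≤ K + K →
  circ (K + K) p q ≤ hamming (thermometer K p) (map not (thermometer K (q ∸ K)))
circ≤hamming-antipodal {K} {p} {q} p≤K K<q q≤2K = begin
  circ (K + K) p q
    ≡⟨ cong (circ (K + K) p) (m+[n∸m]≡n (<⇒≤ K<q)) ⟨
  circ (K + K) p (K + (q ∸ K))
    ≤⟨ circ-antipodal (q ∸ K) p≤K ⟩
  K ∸ ∣ p - q ∸ K ∣
    ≡⟨ cong (K ∸_) (hamming-thermometer p≤K q∸K≤K) ⟨
  K ∸ hamming x y
    ≡⟨ cong (_∸ hamming x y) (hamming-complement x y) ⟨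
  hamming x (map not y) + hamming x y ∸ hamming x y
    ≡⟨ m+n∸n≡m (hamming x (map not y)) (hamming x y) ⟩
  hamming x (map not y) ∎
  where
  open ≤-Reasoning
  q∸K≤K = m≤n+o⇒m∸n≤o q K q≤2K
  x = thermometer K p
  y = thermometer K (q ∸ K)

circ≤hamming-cyclic : ∀ {K p q} → p ≤ K + K → q ≤ K + K →
                      circ (K + K) p q ≤ hamming (cyclic K p) (cyclic K q)
circ≤hamming-cyclic {K} {p} {q} p≤2K q≤2K with p ≤? K | q ≤? K
... | yes p≤K | yes q≤K = begin
  circ (K + K) p q                            ≤⟨ m⊓n≤m _ _ ⟩
  ∣ p - q ∣                                   ≡⟨ hamming-thermometer p≤K q≤K ⟨
  hamming (thermometer K p) (thermometer K q) ∎
  where open ≤-Reasoning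
... | yes p≤K | no q≰K  = circ≤hamming-antipodal p≤K (≰⇒> q≰K) q≤2K
... | no p≰K  | yes q≤K =
  subst₂ _≤_ (circ-comm (K + K) q p) (hamming-comm (thermometer K q) (map not (thermometer K (p ∸ K))))
    (circ≤hamming-antipodal q≤K (≰⇒> p≰K) p≤2K)
... | no p≰K  | no q≰K  = begin
  circ (K + K) p q                 ≤⟨ m⊓n≤m _ _ ⟩
  ∣ p - q ∣                        ≡⟨ ∣m∸o-n∸o∣≡∣m-n∣ K≤p K≤q ⟨
  ∣ p ∸ K - q ∸ K ∣                ≡⟨ hamming-thermometer p∸K≤K q∸K≤K ⟨
  hamming x y                      ≡⟨ hamming-map-not x y ⟨
  hamming (map not x) (map not y)  ∎
  where
  open ≤-Reasoning
  K≤p = <⇒≤ (≰⇒> p≰K)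
  K≤q = <⇒≤ (≰⇒> q≰K)
  p∸K≤K = m≤n+o⇒m∸n≤o p K p≤2K
  q∸K≤K = m≤n+o⇒m∸n≤o q K q≤2K
  x = thermometer K (p ∸ K)
  y = thermometer K (q ∸ K)

⌊n/2⌋+⌊n/2⌋≤n : ∀ n → ⌊ n /2⌋ + ⌊ n /2⌋ ≤ n
⌊n/2⌋+⌊n/2⌋≤n n =
  subst (⌊ n /2⌋ + ⌊ n /2⌋ ≤_) (⌊n/2⌋+⌈n/2⌉≡n n) (+-monoʳ-≤ ⌊ n /2⌋ (⌊n/2⌋≤⌈n/2⌉ n))

n≤⌈n/2⌉+⌈n/2⌉ : ∀ n → n ≤ ⌈ n /2⌉ + ⌈ n /2⌉
n≤⌈n/2⌉+⌈n/2⌉ n =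
  subst (_≤ ⌈ n /2⌉ + ⌈ n /2⌉) (⌊n/2⌋+⌈n/2⌉≡n n) (+-monoˡ-≤ ⌈ n /2⌉ (⌊n/2⌋≤⌈n/2⌉ n))

⌈n/2⌉≤1+⌊n/2⌋ : ∀ n → ⌈ n /2⌉ ≤ suc ⌊ n /2⌋
⌈n/2⌉≤1+⌊n/2⌋ n = ⌈n/2⌉-mono (n≤1+n n)

n≤⌊n/2⌋+[1+⌊n/2⌋] : ∀ n → n ≤ ⌊ n /2⌋ + suc ⌊ n /2⌋
n≤⌊n/2⌋+[1+⌊n/2⌋] n =
  subst (_≤ ⌊ n /2⌋ + suc ⌊ n /2⌋) (⌊n/2⌋+⌈n/2⌉≡n n) (+-monoʳ-≤ ⌊ n /2⌋ (⌈n/2⌉≤1+⌊n/2⌋ n))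

0<n⇒⌊n/2⌋<n : ∀ {n} → 0 < n → ⌊ n /2⌋ < n
0<n⇒⌊n/2⌋<n {suc n} _ = ⌊n/2⌋<n n

m+m≤1+n+n⇒m≤n : ∀ {m n} → m + m ≤ suc (n + n) → m ≤ n
m+m≤1+n+n⇒m≤n {m} {n} le = subst₂ _≤_ (sym (n≡⌊n+n/2⌋ m)) (sym (n≡⌈n+n/2⌉ n)) (⌊n/2⌋-mono le)

⌈m/2⌉+n≤o : ∀ {m n o} → m + n + n ≤ o + o → ⌈ m /2⌉ + n ≤ o
⌈m/2⌉+n≤o {m} {n} {o} le = m+m≤1+n+n⇒m≤n (begin
  (K + n) + (K + n)  ≡⟨ regroup K n ⟩
  (K + K) + n + n    ≤⟨ +-monoˡ-≤ n (+-monoˡ-≤ n K+K≤1+m) ⟩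
  suc m + n + n      ≤⟨ s≤s le ⟩
  suc (o + o)        ∎)
  where
  open ≤-Reasoning
  K = ⌈ m /2⌉
  K+K≤1+m : K + K ≤ suc m
  K+K≤1+m = subst (K + K ≤_) (cong suc (⌊n/2⌋+⌈n/2⌉≡n m)) (+-monoˡ-≤ K (⌈n/2⌉≤1+⌊n/2⌋ m))
  regroup : ∀ k n → (k + n) + (k + n) ≡ (k + k) + n + n
  regroup = solve-∀

position : ∀ {n} → (Fin n → ℕ) → Fin n → ℕ
position w fzero    = 0
position w (fsuc i) = w fzero + position (w ∘ fsuc) i

position-mono : ∀ {n} (w : Fin n → ℕ) {i j} → toℕ i ≤ toℕ j → position w i ≤ position w j
position-mono w {fzero}              _         = z≤n
position-mono w {fsuc i} {fsuc j} (s≤s i≤j) = +-monoʳ-≤ (w fzero) (position-mono (w ∘ fsuc) i≤j)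

position-step : ∀ {n} (w : Fin n → ℕ) {i j} → suc (toℕ i) ≡ toℕ j → position w j ≡ position w i + w i
position-step w {fzero}  {fsuc fzero} refl = +-identityʳ (w fzero)
position-step w {fsuc i} {fsuc j}     eq   = begin
  w fzero + position (w ∘ fsuc) j                ≡⟨ cong (w fzero +_) (position-step (w ∘ fsuc) eq′) ⟩
  w fzero + (position (w ∘ fsuc) i + w (fsuc i)) ≡⟨ +-assoc (w fzero) _ _ ⟨
  w fzero + position (w ∘ fsuc) i + w (fsuc i)   ∎
  where
  open ≡-Reasoning
  eq′ = suc-injective eq

position-last : ∀ {n} (w : Fin n → ℕ) {i} → suc (toℕ i) ≡ n → position w i + w i ≡ sum w
position-last w {fzero}  refl = sym (+-identityʳ (w fzero))
position-last w {fsuc i} eq   = begin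
  w fzero + position (w ∘ fsuc) i + w (fsuc i)   ≡⟨ +-assoc (w fzero) _ _ ⟩
  w fzero + (position (w ∘ fsuc) i + w (fsuc i)) ≡⟨ cong (w fzero +_) (position-last (w ∘ fsuc) eq′) ⟩
  w fzero + sum (w ∘ fsuc)                       ∎
  where
  open ≡-Reasoning
  eq′ = suc-injective eq

position≤sum : ∀ {n} (w : Fin n → ℕ) i → position w i ≤ sum w
position≤sum w fzero    = z≤n
position≤sum w (fsuc i) = +-monoʳ-≤ (w fzero) (position≤sum (w ∘ fsuc) i)

locate : ∀ {n} (w : Fin n → ℕ) t → t < sum w → ∃[ i ] position w i ≤ t × t < position w i + w i
locate {suc n} w t t<W with t <? w fzero
... | yes t<w₀ = fzero , z≤n , t<w₀
... | no  t≮w₀ with r , refl ← m≤n⇒∃[o]m+o≡n (≮⇒≥ t≮w₀)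
                 with i , i≤r , r<i+wᵢ ← locate (w ∘ fsuc) r (+-cancelˡ-< (w fzero) _ _ t<W) =
  fsuc i , +-monoʳ-≤ (w fzero) i≤r ,
  subst (w fzero + r <_) (sym (+-assoc (w fzero) _ _)) (+-monoʳ-< (w fzero) r<i+wᵢ)

antipodal-edge : ∀ {n} (w : Fin n → ℕ) → 0 < sum w →
  ∃[ i ] position w i + position w i ≤ sum w × sum w ≤ (position w i + w i) + (position w i + w i)
antipodal-edge w W>0
  with i , i≤T , T<i+wᵢ ← locate w ⌊ sum w /2⌋ (0<n⇒⌊n/2⌋<n W>0) = i , before , after
  where
  open ≤-Reasoning
  W = sum w
  T = ⌊ W /2⌋
  before : position w i + position w i ≤ W
  before = begin
    position w i + position w i ≤⟨ +-mono-≤ i≤T i≤T ⟩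
    T + T                       ≤⟨ ⌊n/2⌋+⌊n/2⌋≤n W ⟩
    W                           ∎
  after : W ≤ (position w i + w i) + (position w i + w i)
  after = begin
    W                                           ≤⟨ n≤⌊n/2⌋+[1+⌊n/2⌋] W ⟩
    T + suc T                                   ≤⟨ +-mono-≤ (<⇒≤ T<i+wᵢ) T<i+wᵢ ⟩
    (position w i + w i) + (position w i + w i) ∎

StepEdges : ∀ {n} → (Fin n → ℕ) → EdgeRel (Fin n) → Set
StepEdges w E = ∀ {i j} → suc (toℕ i) ≡ toℕ j → E i j (w i)

shiftʷ : ∀ {n} {E : EdgeRel (Fin (suc n))} {i j l} →
         Walk (λ a b → E (fsuc a) (fsuc b)) i j l → Walk E (fsuc i) (fsuc j) l
shiftʷ = mapʷ fsuc id

forward-walk : ∀ {n} {w : Fin n → ℕ} {E} → StepEdges w E →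
               ∀ {i j} → toℕ i ≤ toℕ j → Walk E i j (position w j ∸ position w i)
forward-walk step {fzero} {fzero} _ = nil
forward-walk {suc (suc n)} {w} step {fzero} {fsuc j} _ =
  cons (step refl) (shiftʷ (forward-walk {w = w ∘ fsuc} (step ∘ cong suc) {fzero} {j} z≤n))
forward-walk {w = w} {E} step {fsuc i} {fsuc j} (s≤s i≤j) =
  subst (Walk E _ _) (sym ([m+n]∸[m+o]≡n∸o (w fzero) _ _))
    (shiftʷ (forward-walk {w = w ∘ fsuc} (step ∘ cong suc) i≤j))

interval-walk : ∀ {n} {w : Fin n → ℕ} {E} → StepEdges w E → Undirected E →
                ∀ i j → Walk E i j ∣ position w i - position w j ∣
interval-walk {w = w} {E} step flip i j with ≤-total (toℕ i) (toℕ j)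
... | inj₁ i≤j = subst (Walk E i j) (sym (m≤n⇒∣m-n∣≡n∸m (position-mono w i≤j)))
                   (forward-walk step i≤j)
... | inj₂ j≤i = subst (Walk E i j) (sym (m≤n⇒∣n-m∣≡n∸m (position-mono w j≤i)))
                   (reverse flip (forward-walk step j≤i))

cycle-successor : ∀ {n} (i : Fin n) → ∃ (CycSucc i)
cycle-successor {suc n} i with suc (toℕ i) <? suc n
... | yes i+1<n = fromℕ< i+1<n , inj₁ (sym (toℕ-fromℕ< i+1<n))
... | no  i+1≮n = fzero , inj₂ (≤-antisym (toℕ<n i) (≮⇒≥ i+1≮n) , refl)

module Cycle {n : ℕ} (w : Fin (suc n) → ℕ) where

  C : EdgeRel (Fin (suc n))
  C = CycleE (suc n) w

  W : ℕ
  W = sum w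

  flipC : Undirected C
  flipC (fwd s) = bwd s
  flipC (bwd s) = fwd s

  stepC : StepEdges w C
  stepC next = fwd (inj₁ next)

  0<W : IsWeighted C → 0 < W
  0<W (positive , _) = ≤-trans (positive _ _ _ (fwd (proj₂ (cycle-successor fzero)))) (m≤m+n _ _)

  around-walk≤ : ∀ {i j} → toℕ i ≤ toℕ j → Walk C j i (W ∸ (position w j ∸ position w i))
  around-walk≤ {i} {j} i≤j =
    subst (Walk C j i) (trans (length (w last) (position-mono w i≤j) (position-mono w (≤fromℕ j)))
                              (cong (_∸ (position w j ∸ position w i)) (position-last w wraps)))
      (forward-walk stepC (≤fromℕ j) ++ʷ
       cons (fwd (inj₂ (wraps , refl))) (forward-walk stepC {fzero} {i} z≤n))
    where
    last = fromℕ n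
    wraps : suc (toℕ last) ≡ suc n
    wraps = cong suc (toℕ-fromℕ n)
    length : ∀ {a b c} x → a ≤ b → b ≤ c → (c ∸ b) + (x + a) ≡ (c + x) ∸ (b ∸ a)
    length {a} x a≤b b≤c
      with r , refl ← m≤n⇒∃[o]m+o≡n a≤b
      with s , refl ← m≤n⇒∃[o]m+o≡n b≤c = begin
      (a + r + s ∸ (a + r)) + (x + a) ≡⟨ cong (_+ (x + a)) (m+n∸m≡n (a + r) s) ⟩
      s + (x + a)                     ≡⟨ m+n∸m≡n r (s + (x + a)) ⟨
      r + (s + (x + a)) ∸ r           ≡⟨ cong₂ _∸_ (regroup a r s x) (m+n∸m≡n a r) ⟨
      (a + r + s + x) ∸ (a + r ∸ a)   ∎
      where
      open ≡-Reasoning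
      regroup : ∀ a r s x → a + r + s + x ≡ r + (s + (x + a))
      regroup = solve-∀

  around-walk : ∀ u v → Walk C u v (W ∸ ∣ position w u - position w v ∣)
  around-walk u v with ≤-total (toℕ u) (toℕ v)
  ... | inj₁ u≤v = subst (λ x → Walk C u v (W ∸ x)) (sym (m≤n⇒∣m-n∣≡n∸m (position-mono w u≤v)))
                     (reverse flipC (around-walk≤ u≤v))
  ... | inj₂ v≤u = subst (λ x → Walk C u v (W ∸ x)) (sym (m≤n⇒∣n-m∣≡n∸m (position-mono w v≤u)))
                     (around-walk≤ v≤u)

  distance≤circ : ∀ {u v d} → IsDist C u v d → d ≤ circ W (position w u) (position w v)
  distance≤circ {u} {v} (_ , minimal) =
    ⊓-glb (minimal _ (interval-walk stepC flipC u v)) (minimal _ (around-walk u v))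

  cycle-addressing : IsAddressing C ⌈ W /2⌉ (cyclic ⌈ W /2⌉ ∘ position w)
  cycle-addressing u v d dist = begin
    d                       ≤⟨ distance≤circ dist ⟩
    circ W p q              ≤⟨ circ-mono p q W≤2K ⟩
    circ (K + K) p q        ≤⟨ circ≤hamming-cyclic (≤-trans (position≤sum w u) W≤2K)
                                                   (≤-trans (position≤sum w v) W≤2K) ⟩
    hamming (cyclic K p) (cyclic K q) ∎
    where
    open ≤-Reasoning
    K = ⌈ W /2⌉
    W≤2K = n≤⌈n/2⌉+⌈n/2⌉ W
    p = position w u
    q = position w v

  circ-step : ∀ {i j} → CycSucc i j → circ W 0 (position w j) ≡ circ W 0 (position w i + w i)
  circ-step (inj₁ next) = cong (circ W 0) (position-step w next)
  circ-step {i} {j} (inj₂ (wraps , j≡0)) = begin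
    circ W 0 (position w j)        ≡⟨ cong (circ W 0 ∘ position w) (toℕ-injective {j = fzero} j≡0) ⟩
    0                              ≡⟨ ⊓-zeroʳ W ⟨
    W ⊓ 0                          ≡⟨ cong (W ⊓_) (n∸n≡0 W) ⟨
    circ W 0 W                     ≡⟨ cong (circ W 0) (position-last w wraps) ⟨
    circ W 0 (position w i + w i)  ∎
    where open ≡-Reasoning

  circ-potential : ∀ {u v l} → Walk C u v l → circ W 0 (position w v) ≤ circ W 0 (position w u) + l
  circ-potential = potential-bound (circ W 0 ∘ position w) lipschitz
    where
    lipschitz : ∀ {u v k} → C u v k → circ W 0 (position w v) ≤ circ W 0 (position w u) + k
    lipschitz (fwd {i} {j} s) = begin
      circ W 0 (position w j)       ≡⟨ circ-step s ⟩
      circ W 0 (p + w i)            ≤⟨ circ-lipschitz W 0 p (p + w i) ⟩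
      circ W 0 p + ∣ p - p + w i ∣  ≡⟨ cong (circ W 0 p +_) (∣m-m+n∣≡n p (w i)) ⟩
      circ W 0 p + w i              ∎
      where
      open ≤-Reasoning
      p = position w i
    lipschitz (bwd {i} {j} s) = begin
      circ W 0 p                           ≤⟨ circ-lipschitz W 0 (p + w i) p ⟩
      circ W 0 (p + w i) + ∣ p + w i - p ∣ ≡⟨ cong₂ _+_ (sym (circ-step s)) ∣p+wᵢ-p∣≡wᵢ ⟩
      circ W 0 (position w j) + w i        ∎
      where
      open ≤-Reasoning
      p = position w i
      ∣p+wᵢ-p∣≡wᵢ = trans (∣-∣-comm (p + w i) p) (∣m-m+n∣≡n p (w i))

module Path {m : ℕ} (w : Fin (suc m) → ℕ) where

  P : EdgeRel (Fin (suc m))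
  P = PathE (suc m) w

  D : ℕ
  D = position w (fromℕ m)

  flipP : Undirected P
  flipP (fwd s) = bwd s
  flipP (bwd s) = fwd s

  path-addressing : IsAddressing P D (thermometer D ∘ position w)
  path-addressing x y d (_ , minimal) = begin
    d                                ≤⟨ minimal _ (interval-walk fwd flipP x y) ⟩
    ∣ position w x - position w y ∣  ≡⟨ hamming-thermometer (≤D x) (≤D y) ⟨
    hamming (thermometer D (position w x)) (thermometer D (position w y)) ∎
    where
    open ≤-Reasoning
    ≤D : ∀ x → position w x ≤ D
    ≤D x = position-mono w (≤fromℕ x)

  path-potential : ∀ {x y l} → Walk P x y l → position w y ≤ position w x + l
  path-potential = potential-bound (position w) lipschitz
    where
    lipschitz : ∀ {x y k} → P x y k → position w y ≤ position w x + k
    lipschitz (fwd next) = ≤-reflexive (position-step w next)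
    lipschitz (bwd {i} {j} next) = begin
      position w i        ≤⟨ m≤m+n (position w i) (w i) ⟩
      position w i + w i  ≡⟨ position-step w next ⟨
      position w j        ≤⟨ m≤m+n (position w j) (w i) ⟩
      position w j + w i  ∎
      where open ≤-Reasoning

module CyclePath {n m : ℕ} (w : Fin (suc n) → ℕ) (w′ : Fin (suc m) → ℕ) where
  open Cycle w
  open Path w′

  module _ (weighted : IsWeighted C) {M : ℕ} {f : Fin (suc n) × Fin (suc m) → Vec Bool M}
           (addr : IsAddressing (ProdE C P) M f) {i j : Fin (suc n)} (i→j : CycSucc i j) where
    private
      A = position w i
      B = w i
      s₁ s₂ s₃ : Fin (suc n) × Fin (suc m)
      s₁ = fzero , fzero
      s₂ = i , fromℕ m
      s₃ = j , fromℕ m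

      connect : ∀ s t → ∃ (Walk (ProdE C P) s t)
      connect (u , x) (v , y) = _ , □-walk (interval-walk stepC flipC u v) (interval-walk fwd flipP x y)

      side : ∀ s t {b} → (∀ {l} → Walk (ProdE C P) s t l → b ≤ l) → b ≤ hamming (f s) (f t)
      side s t = addressing-bound {f = f} addr (proj₂ (connect s t))

    antipodal-perimeter : A + A ≤ W → W ≤ (A + B) + (A + B) → W + D + D ≤ M + M
    antipodal-perimeter 2A≤W W≤2[A+B] = begin
      W + D + D                        ≤⟨ +-monoˡ-≤ D (+-monoˡ-≤ D (m≤n+m∸n W (A + B))) ⟩
      (A + B) + (W ∸ (A + B)) + D + D  ≡⟨ regroup A B (W ∸ (A + B)) D ⟩
      (A + D) + B + (W ∸ (A + B) + D)  ≤⟨ +-mono-≤ (+-mono-≤ side₁₂ side₂₃) side₃₁ ⟩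
      hamming (f s₁) (f s₂) + hamming (f s₂) (f s₃) + hamming (f s₃) (f s₁)
                                       ≤⟨ hamming-perimeter (f s₁) (f s₂) (f s₃) ⟩
      M + M                            ∎
      where
      open ≤-Reasoning
      regroup : ∀ a b x d → a + b + x + d + d ≡ a + d + b + (x + d)
      regroup = solve-∀
      side₁₂ : A + D ≤ hamming (f s₁) (f s₂)
      side₁₂ = side s₁ s₂ (□-bound (λ p → ≤-trans A≤circ (circ-potential p)) path-potential)
        where
        A≤circ : A ≤ circ W 0 A
        A≤circ = ⊓-glb ≤-refl (m+n≤o⇒m≤o∸n A 2A≤W)
      side₂₃ : B ≤ hamming (f s₂) (f s₃)
      side₂₃ = subst (_≤ hamming (f s₂) (f s₃)) (+-identityʳ B)
                 (side s₂ s₃ (□-bound (proj₂ (proj₂ weighted _ _ _ (fwd i→j)) _) (λ _ → z≤n)))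
      side₃₁ : W ∸ (A + B) + D ≤ hamming (f s₃) (f s₁)
      side₃₁ = side s₃ s₁ (□-bound cycle-part (path-potential ∘ reverse flipP))
        where
        cycle-part : ∀ {l} → Walk C j fzero l → W ∸ (A + B) ≤ l
        cycle-part p = begin
          W ∸ (A + B)              ≤⟨ ⊓-glb (m≤n+o⇒m∸n≤o W (A + B) W≤2[A+B]) ≤-refl ⟩
          circ W 0 (A + B)         ≡⟨ circ-step i→j ⟨
          circ W 0 (position w j)  ≤⟨ circ-potential (reverse flipC p) ⟩
          _                        ∎

  perimeter-bound : IsWeighted C → ∀ {M f} → IsAddressing (ProdE C P) M f → W + D + D ≤ M + M
  perimeter-bound weighted {f = f} addr
    with i , 2A≤W , W≤2[A+B] ← antipodal-edge w (0<W weighted)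
    with j , i→j ← cycle-successor i
    = antipodal-perimeter weighted {f = f} addr i→j 2A≤W W≤2[A+B]

theorem7 : (n m : ℕ) (w : Fin n → ℕ) (w′ : Fin m → ℕ) →
    3 ≤ n → 1 ≤ m →
    IsWeighted (CycleE n w) → IsWeighted (PathE m w′) →
    (a b : ℕ) → IsAddrNumber (CycleE n w) a → IsAddrNumber (PathE m w′) b →
    IsAddrNumber (ProdE (CycleE n w) (PathE m w′)) (a + b)
theorem7 (suc n) (suc m) w w′ _ _ weighted _ a b ((f , f-addr) , a-least) ((g , g-addr) , b-least) =
  ((λ (u , x) → f u ++ g x) , □-addressing {f = f} {g} f-addr g-addr) , λ M h h-addr → begin
    a + b        ≤⟨ +-mono-≤ (a-least _ (cyclic ⌈ W /2⌉ ∘ position w) cycle-addressing)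
                             (b-least _ (thermometer D ∘ position w′) path-addressing) ⟩
    ⌈ W /2⌉ + D  ≤⟨ ⌈m/2⌉+n≤o {W} {D} (perimeter-bound weighted {f = h} h-addr) ⟩
    M            ∎
  where
  open ≤-Reasoning
  open Cycle w
  open Path w′
  open CyclePath w w′
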